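{- Let $n\geq 3$ and let $w$ be a rich square-free word with $|\mathrm{Alph}(w)|=n$. Write $w=xByAz$, where $x,y,z$ are words, $A,B$ are letters, the displayed occurrence of $A$ is the right special letter of $w$ and the displayed occurrence of $B$ is the left special letter of $w$. Then $\mathrm{Alph}(y)=\mathrm{Alph}(w)\setminus\{A,B\}$ and $A\neq B$.
   Context: $\mathrm{Alph}(x)$ is the set of letters occurring in $x$. A palindrome is a word equal to its reversal. A word $w$ is rich if it has exactly $|w|+1$ distinct palindromic factors, counting the empty word. A word is square-free if it has no factor $uu$ with $u$ non-empty. For a word $w=uav$ with $a$ a letter: if $\mathrm{Alph}(u)=\mathrm{Alph}(w)\setminus\{a\}$, then this occurrence of $a$ (which is the leftmost occurrence of $a$ in $w$) is called the left special letter of $w$; if $\mathrm{Alph}(v)=\mathrm{Alph}(w)\setminus\{a\}$, then this occurrence of $a$ (the rightmost occurrence of $a$) is called the right special letter of $w$. -}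

module Defs where

open import Data.List using (List; []; _∷_; _++_; length; reverse; filter; deduplicate; concatMap; inits; tails)
open import Data.List.Membership.Propositional using (_∈_)
open import Data.List.Properties using (≡-dec)
open import Data.Nat using (ℕ; suc)
open import Data.Product using (_×_; ∃)
open import Relation.Binary.Definitions using (DecidableEquality)
open import Relation.Binary.PropositionalEquality using (_≡_; _≢_)
open import Relation.Nullary using (¬_)
open import Function.Bundles using (_⇔_)

module _ {A : Set} (_≟_ : DecidableEquality A) where

  factors : List A → List (List A)
  factors w = concatMap inits (tails w)

  _≟w_ : DecidableEquality (List A)
  _≟w_ = ≡-dec _≟_

  IsPalindrome : List A → Set
  IsPalindrome u = reverse u ≡ u

  -- the distinct palindromic factors of w (the empty word included)
  palFactors : List A → List (List A)
  palFactors w = deduplicate _≟w_ (filter (λ u → reverse u ≟w u) (factors w))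

  Rich : List A → Set
  Rich w = length (palFactors w) ≡ suc (length w)

  alphSize : List A → ℕ
  alphSize w = length (deduplicate _≟_ w)

module _ {A : Set} where

  SquareFree : List A → Set
  SquareFree w = ∀ (p u s : List A) → u ≢ [] → ¬ (w ≡ p ++ u ++ u ++ s)

  AlphMinus : List A → List A → A → Set
  AlphMinus u w a = ∀ c → (c ∈ u) ⇔ ((c ∈ w) × (c ≢ a))

module Submission where

-- Richness is used only through a classical consequence: every complete return c u c to a letter
-- (c ∉ u) has a palindromic middle u. This follows by counting: appending a letter creates at most
-- one new palindromic factor, and closing a return with non-palindromic middle creates none, so w
-- would have fewer than |w| + 1 palindromic factors. Square-free words with palindromic returns
-- ("admissible") are closed under factors and mirror image, and the mirror image swaps a and b.
-- The theorem for admissible words is proved by induction on |w|: a recurring first letter of x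
-- (or last letter of z) is dropped; otherwise the first return to the first letter of x shows that
-- x̃ is a prefix of y a z, and dually z̃ a suffix of x b y. If both stop before the special letters,
-- x = x₀ a ỹ and z = ỹ b z₁, and any letter outside y yields a return forcing a = b; if one reaches
-- into y, the induction hypothesis on proper factors leads to a contradiction or a square.

open import Defs
import Algebra.Solver.Monoid as MonoidSolver
open import Data.Empty using (⊥; ⊥-elim)
open import Data.List using (List; []; _∷_; _++_; _∷ʳ_; [_]; length; reverse; filter; inits; tails; map; initLast; _∷ʳ′_)
open import Data.List.Properties
  using (++-monoid; ++-assoc; ++-identityʳ; ∷-injective; ∷-injectiveʳ; ∷ʳ-injective; length-++; length-++-comm;
         length-map; length-reverse; reverse-++; reverse-involutive; reverse-injective; unfold-reverse; ≡-dec)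
open import Data.List.Membership.Propositional using (_∈_; _∉_; find; lose)
open import Data.List.Membership.Propositional.Properties
  using (∈-++⁺ˡ; ∈-++⁺ʳ; ∈-++⁻; ∈-map⁺; ∈-map⁻; ∈-concatMap⁺; ∈-concatMap⁻; ∈-filter⁺; ∈-filter⁻;
         ∈-deduplicate⁺; ∈-deduplicate⁻)
import Data.List.Membership.DecPropositional as DecMembership
open import Data.List.Relation.Unary.All using (lookup)
open import Data.List.Relation.Unary.Any using (here; there; any?)
import Data.List.Relation.Unary.Any.Properties as AnyProperties
open import Data.List.Relation.Unary.Unique.Propositional using (Unique; []; _∷_)
import Data.List.Relation.Unary.Unique.Propositional.Properties as UniqueProperties
import Data.List.Relation.Unary.Unique.DecPropositional.Properties as DecUniqueProperties
open import Data.Nat using (ℕ; suc; _+_; _≤_; _<_; _≥_; z≤n; s≤s)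
open import Data.Nat.Properties
  using (≤-refl; ≤-trans; <-≤-trans; 1+n≰n; m≤n+m; m≤m+n; <-cmp; <-irrefl; +-mono-<; +-monoˡ-≤; +-monoʳ-≤; +-suc;
         suc-injective; module ≤-Reasoning)
open import Data.Product using (_×_; _,_; ∃; ∃₂; proj₁; proj₂)
open import Data.Sum using (_⊎_; inj₁; inj₂)
open import Function.Bundles using (_⇔_; mk⇔; Equivalence)
open import Relation.Binary.Definitions using (DecidableEquality; tri<; tri≈; tri>)
open import Relation.Binary.PropositionalEquality
  using (_≡_; _≢_; refl; sym; trans; cong; cong₂; subst; module ≡-Reasoning)
open import Relation.Nullary using (¬_; ¬?; Dec; yes; no)

double-injective : ∀ m n → m + m ≡ n + n → m ≡ n
double-injective m n eq with <-cmp m n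
... | tri< m<n _ _ = ⊥-elim (<-irrefl eq (+-mono-< m<n m<n))
... | tri≈ _ m≡n _ = m≡n
... | tri> _ _ n<m = ⊥-elim (<-irrefl (sym eq) (+-mono-< n<m n<m))

module _ {A : Set} where

  Factor : List A → List A → Set
  Factor u w = ∃₂ λ p s → w ≡ p ++ u ++ s

  -- the palindrome predicate of Defs, without its (unused) decidable-equality parameter
  Palindrome : List A → Set
  Palindrome u = reverse u ≡ u

  ReturnsPalindromic : List A → Set
  ReturnsPalindromic w = ∀ s c u t → c ∉ u → w ≡ s ++ c ∷ u ++ c ∷ t → Palindrome u

  ∈-reverse⁺ : ∀ {c} {u : List A} → c ∈ u → c ∈ reverse u
  ∈-reverse⁺ = AnyProperties.reverse⁺

  ∈-reverse⁻ : ∀ {c} {u : List A} → c ∈ reverse u → c ∈ u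
  ∈-reverse⁻ = AnyProperties.reverse⁻

  reverse-≢[] : ∀ {u : List A} → u ≢ [] → reverse u ≢ []
  reverse-≢[] {u} u≢[] ru≡[] = u≢[] (reverse-injective {x = u} ru≡[])

  reverse-mid : ∀ (p : List A) c q → reverse (p ++ c ∷ q) ≡ reverse q ++ c ∷ reverse p
  reverse-mid p c q = begin
    reverse (p ++ c ∷ q)           ≡⟨ reverse-++ p (c ∷ q) ⟩
    reverse (c ∷ q) ++ reverse p   ≡⟨ cong (_++ reverse p) (unfold-reverse c q) ⟩
    (reverse q ∷ʳ c) ++ reverse p  ≡⟨ ++-assoc (reverse q) [ c ] (reverse p) ⟩
    reverse q ++ c ∷ reverse p     ∎
    where open ≡-Reasoning

  reverse-mid⁻ : ∀ {y : List A} p c q → reverse y ≡ p ++ c ∷ q → y ≡ reverse q ++ c ∷ reverse p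
  reverse-mid⁻ {y} p c q eq = trans (sym (reverse-involutive y)) (trans (cong reverse eq) (reverse-mid p c q))

  centred-palindrome : ∀ (X : List A) c → Palindrome (reverse X ++ c ∷ X)
  centred-palindrome X c = trans (reverse-mid (reverse X) c X) (cong (λ v → reverse X ++ c ∷ v) (reverse-involutive X))

  levi : ∀ (p₁ s₁ p₂ s₂ : List A) → p₁ ++ s₁ ≡ p₂ ++ s₂ →
         (∃ λ m → p₁ ≡ p₂ ++ m × s₂ ≡ m ++ s₁) ⊎ (∃ λ m → p₂ ≡ p₁ ++ m × s₁ ≡ m ++ s₂)
  levi p₁ s₁ [] s₂ eq = inj₁ (p₁ , refl , sym eq)
  levi [] s₁ (c ∷ p₂) s₂ eq = inj₂ (c ∷ p₂ , refl , eq)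
  levi (c ∷ p₁) s₁ (d ∷ p₂) s₂ eq with ∷-injective eq
  ... | refl , eq′ with levi p₁ s₁ p₂ s₂ eq′
  ...   | inj₁ (m , e₁ , e₂) = inj₁ (m , cong (c ∷_) e₁ , e₂)
  ...   | inj₂ (m , e₁ , e₂) = inj₂ (m , cong (c ∷_) e₁ , e₂)

  levi-suffix : ∀ (p₁ s₁ p₂ s₂ : List A) → p₁ ++ s₁ ≡ p₂ ++ s₂ →
                (∃ λ m → s₂ ≡ m ++ s₁) ⊎ (∃ λ m → s₁ ≡ m ++ s₂)
  levi-suffix p₁ s₁ p₂ s₂ eq with levi p₁ s₁ p₂ s₂ eq
  ... | inj₁ (m , _ , e) = inj₁ (m , e)
  ... | inj₂ (m , _ , e) = inj₂ (m , e)

  split-equal-length : ∀ (p₁ s₁ p₂ s₂ : List A) → p₁ ++ s₁ ≡ p₂ ++ s₂ → length p₁ ≡ length p₂ →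
                       p₁ ≡ p₂ × s₁ ≡ s₂
  split-equal-length [] s₁ [] s₂ eq _ = refl , eq
  split-equal-length (c ∷ p₁) s₁ (d ∷ p₂) s₂ eq len with ∷-injective eq
  ... | refl , eq′ with split-equal-length p₁ s₁ p₂ s₂ eq′ (suc-injective len)
  ...   | e₁ , e₂ = cong (c ∷_) e₁ , e₂

  reverse-≡-palindrome : ∀ {y P : List A} → Palindrome P → reverse y ≡ P → y ≡ P
  reverse-≡-palindrome {y} pal eq = trans (sym (reverse-involutive y)) (trans (cong reverse eq) pal)

  centred-unique : ∀ (X : List A) e Z e′ → reverse X ++ e ∷ X ≡ reverse Z ++ e′ ∷ Z → e ≡ e′ × X ≡ Z
  centred-unique X e Z e′ eq = ∷-injective (proj₂ (split-equal-length _ _ _ _ eq same-length))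
    where
    open ≡-Reasoning
    half : ∀ (V : List A) c → length (reverse V ++ c ∷ V) ≡ suc (length V + length V)
    half V c = begin
      length (reverse V ++ c ∷ V)        ≡⟨ length-++ (reverse V) ⟩
      length (reverse V) + suc (length V) ≡⟨ cong (_+ suc (length V)) (length-reverse V) ⟩
      length V + suc (length V)          ≡⟨ +-suc (length V) (length V) ⟩
      suc (length V + length V)          ∎
    same-length : length (reverse X) ≡ length (reverse Z)
    same-length = begin
      length (reverse X) ≡⟨ length-reverse X ⟩
      length X           ≡⟨ double-injective (length X) (length Z)
                              (suc-injective (trans (sym (half X e)) (trans (cong length eq) (half Z e′)))) ⟩
      length Z           ≡⟨ length-reverse Z ⟨
      length (reverse Z) ∎

  align : ∀ (p₁ : List A) α q₁ p₂ β q₂ → p₁ ++ α ∷ q₁ ≡ p₂ ++ β ∷ q₂ → β ∉ p₁ →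
          (p₁ ≡ p₂ × α ≡ β × q₁ ≡ q₂) ⊎ (∃ λ k → p₂ ≡ p₁ ++ α ∷ k × q₁ ≡ k ++ β ∷ q₂)
  align [] α q₁ [] β q₂ eq _ with ∷-injective eq
  ... | refl , e = inj₁ (refl , refl , e)
  align [] α q₁ (c ∷ p₂) β q₂ eq _ with ∷-injective eq
  ... | refl , e = inj₂ (p₂ , refl , e)
  align (c ∷ p₁) α q₁ [] β q₂ eq β∉ with ∷-injective eq
  ... | refl , _ = ⊥-elim (β∉ (here refl))
  align (c ∷ p₁) α q₁ (d ∷ p₂) β q₂ eq β∉ with ∷-injective eq
  ... | refl , e with align p₁ α q₁ p₂ β q₂ e (λ m → β∉ (there m))
  ...   | inj₁ (e₁ , e₂ , e₃) = inj₁ (cong (c ∷_) e₁ , e₂ , e₃)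
  ...   | inj₂ (k , e₁ , e₂) = inj₂ (k , cong (c ∷_) e₁ , e₂)

  align-first : ∀ (p₁ : List A) α q₁ p₂ β q₂ → p₁ ++ α ∷ q₁ ≡ p₂ ++ β ∷ q₂ → β ∉ p₁ → α ∉ p₂ →
                p₁ ≡ p₂ × α ≡ β × q₁ ≡ q₂
  align-first p₁ α q₁ p₂ β q₂ eq β∉ α∉ with align p₁ α q₁ p₂ β q₂ eq β∉
  ... | inj₁ same = same
  ... | inj₂ (k , refl , _) = ⊥-elim (α∉ (∈-++⁺ʳ p₁ (here refl)))

  prefix-or-past : ∀ (p q g : List A) α r → p ++ q ≡ g ++ α ∷ r →
                   (∃ λ k → g ≡ p ++ k) ⊎ (∃ λ k → p ≡ g ++ α ∷ k)
  prefix-or-past [] q g α r eq = inj₁ (g , refl)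
  prefix-or-past (c ∷ p) q [] α r eq with ∷-injective eq
  ... | refl , _ = inj₂ (p , refl)
  prefix-or-past (c ∷ p) q (d ∷ g) α r eq with ∷-injective eq
  ... | refl , e with prefix-or-past p q g α r e
  ...   | inj₁ (k , e′) = inj₁ (k , cong (c ∷_) e′)
  ...   | inj₂ (k , e′) = inj₂ (k , cong (c ∷_) e′)

  factor-reverse : ∀ {u w : List A} → Factor u (reverse w) → Factor (reverse u) w
  factor-reverse {u} {w} (p , s , eq) = reverse s , reverse p , (begin
    w                                    ≡⟨ reverse-involutive w ⟨
    reverse (reverse w)                  ≡⟨ cong reverse eq ⟩
    reverse (p ++ u ++ s)                ≡⟨ reverse-++ p (u ++ s) ⟩
    reverse (u ++ s) ++ reverse p        ≡⟨ cong (_++ reverse p) (reverse-++ u s) ⟩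
    (reverse s ++ reverse u) ++ reverse p ≡⟨ ++-assoc (reverse s) (reverse u) (reverse p) ⟩
    reverse s ++ reverse u ++ reverse p  ∎)
    where open ≡-Reasoning

  factor-of-init : ∀ {w : List A} {c} p u s → w ∷ʳ c ≡ p ++ u ++ s → s ≢ [] → Factor u w
  factor-of-init {w} p u s eq s≢[] with initLast s
  ... | [] = ⊥-elim (s≢[] refl)
  ... | s′ ∷ʳ′ d = p , s′ , proj₁ (∷ʳ-injective w (p ++ u ++ s′) (begin
    w ++ [ _ ]           ≡⟨ eq ⟩
    p ++ u ++ s′ ∷ʳ d    ≡⟨ cong (p ++_) (++-assoc u s′ [ d ]) ⟨
    p ++ (u ++ s′) ∷ʳ d  ≡⟨ ++-assoc p (u ++ s′) [ d ] ⟨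
    (p ++ u ++ s′) ∷ʳ d  ∎))
    where open ≡-Reasoning

  delete-one : ∀ {v : A} {ys} → v ∈ ys → ∃ λ zs → (∀ {u} → u ∈ ys → u ≢ v → u ∈ zs) × length ys ≡ suc (length zs)
  delete-one {ys = _ ∷ ys} (here refl) = ys , (λ { (here refl) u≢v → ⊥-elim (u≢v refl) ; (there m) _ → m }) , refl
  delete-one {ys = y ∷ _} (there v∈) with delete-one v∈
  ... | zs , ⊆zs , len = y ∷ zs , (λ { (here refl) _ → here refl ; (there m) u≢v → there (⊆zs m u≢v) }) , cong suc len

  unique-⊆-length : ∀ {xs ys : List A} → Unique xs → (∀ {v} → v ∈ xs → v ∈ ys) → length xs ≤ length ys
  unique-⊆-length {xs = []} _ _ = z≤n
  unique-⊆-length {xs = x ∷ xs} (x∉xs ∷ uniq) xs⊆ys with delete-one (xs⊆ys (here refl))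
  ... | zs , ⊆zs , len = subst (suc (length xs) ≤_) (sym len)
        (s≤s (unique-⊆-length uniq (λ m → ⊆zs (xs⊆ys (there m)) (λ { refl → lookup x∉xs m refl }))))

  reverse-cons-++ : ∀ e (X t : List A) → reverse (e ∷ X) ++ t ≡ reverse X ++ e ∷ t
  reverse-cons-++ e X t = trans (cong (_++ t) (unfold-reverse e X)) (++-assoc (reverse X) [ e ] t)

  shorter-factor : ∀ {w} p c (v s : List A) → w ≡ p ++ c ∷ v ++ s → length v < length w
  shorter-factor p c v s refl = begin-strict
    length v                     ≤⟨ m≤m+n (length v) (length s) ⟩
    length v + length s          ≡⟨ length-++ v ⟨
    length (v ++ s)              <⟨ s≤s ≤-refl ⟩
    length (c ∷ v ++ s)          ≤⟨ m≤n+m _ (length p) ⟩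
    length p + length (c ∷ v ++ s) ≡⟨ length-++ p ⟨
    length (p ++ c ∷ v ++ s)     ∎
    where open ≤-Reasoning

  shorter-suffix : ∀ {w} p c (v : List A) → w ≡ p ++ c ∷ v → length v < length w
  shorter-suffix p c v w≡ = shorter-factor p c v [] (trans w≡ (cong (λ t → p ++ c ∷ t) (sym (++-identityʳ v))))

  ∉-∷ : ∀ {c d} {u : List A} → c ≢ d → c ∉ u → c ∉ d ∷ u
  ∉-∷ c≢d c∉u (here refl) = c≢d refl
  ∉-∷ c≢d c∉u (there m) = c∉u m

  ∉-++ : ∀ {c} {u v : List A} → c ∉ u → c ∉ v → c ∉ u ++ v
  ∉-++ {u = u} c∉u c∉v m with ∈-++⁻ u m
  ... | inj₁ m′ = c∉u m′
  ... | inj₂ m′ = c∉v m′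


module Occurrences {A : Set} (_≟_ : DecidableEquality A) where

  first-occurrence : ∀ c (u : List A) → c ∈ u → ∃₂ λ p q → u ≡ p ++ c ∷ q × c ∉ p
  first-occurrence c (d ∷ u) c∈ with d ≟ c
  ... | yes refl = [] , u , refl , λ ()
  first-occurrence c (d ∷ u) (here refl) | no d≢c = ⊥-elim (d≢c refl)
  first-occurrence c (d ∷ u) (there c∈) | no d≢c with first-occurrence c u c∈
  ... | p , q , refl , c∉p = d ∷ p , q , refl , λ { (here refl) → d≢c refl ; (there m) → c∉p m }

  last-occurrence : ∀ c (u : List A) → c ∈ u → ∃₂ λ p q → u ≡ p ++ c ∷ q × c ∉ q
  last-occurrence c u c∈ with first-occurrence c (reverse u) (∈-reverse⁺ c∈)
  ... | p , q , eq , c∉p = reverse q , reverse p , reverse-mid⁻ p c q eq , λ m → c∉p (∈-reverse⁻ m)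

-- Counting palindromic factors

module PalindromicFactors {A : Set} (_≟_ : DecidableEquality A) where

  PalFactor : List A → List A → Set
  PalFactor u w = Factor u w × Palindrome u

  #pal : List A → ℕ
  #pal w = length (palFactors _≟_ w)

  private
    palindrome? : (u : List A) → Dec (Palindrome u)
    palindrome? u = ≡-dec _≟_ (reverse u) u

    prefix∈inits : ∀ (u s : List A) → u ∈ inits (u ++ s)
    prefix∈inits [] s = here refl
    prefix∈inits (c ∷ u) s = there (∈-map⁺ (c ∷_) (prefix∈inits u s))

    inits-prefix : ∀ {u} (t : List A) → u ∈ inits t → ∃ λ s → t ≡ u ++ s
    inits-prefix [] (here refl) = [] , refl
    inits-prefix (c ∷ t) (here refl) = c ∷ t , refl
    inits-prefix (c ∷ t) (there m) with ∈-map⁻ (c ∷_) m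
    ... | u , m′ , refl with inits-prefix t m′
    ...   | s , eq = s , cong (c ∷_) eq

    suffix∈tails : ∀ (p t : List A) → t ∈ tails (p ++ t)
    suffix∈tails [] [] = here refl
    suffix∈tails [] (c ∷ t) = here refl
    suffix∈tails (c ∷ p) t = there (suffix∈tails p t)

    tails-suffix : ∀ {t} (w : List A) → t ∈ tails w → ∃ λ p → w ≡ p ++ t
    tails-suffix [] (here refl) = [] , refl
    tails-suffix (c ∷ w) (here refl) = [] , refl
    tails-suffix (c ∷ w) (there m) with tails-suffix w m
    ... | p , eq = c ∷ p , cong (c ∷_) eq

  factor⁺ : ∀ {u w} → Factor u w → u ∈ factors _≟_ w
  factor⁺ (p , s , refl) = ∈-concatMap⁺ inits (lose (suffix∈tails p (_ ++ s)) (prefix∈inits _ s))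

  factor⁻ : ∀ {u w} → u ∈ factors _≟_ w → Factor u w
  factor⁻ {w = w} m with find (∈-concatMap⁻ inits {xs = tails w} m)
  ... | t , t∈ , u∈ with tails-suffix w t∈ | inits-prefix t u∈
  ...   | p , refl | s , refl = p , s , refl

  palFactor⁺ : ∀ {u w} → PalFactor u w → u ∈ palFactors _≟_ w
  palFactor⁺ (f , pal) = ∈-deduplicate⁺ (_≟w_ _≟_) (∈-filter⁺ palindrome? (factor⁺ f) pal)

  palFactor⁻ : ∀ {u w} → u ∈ palFactors _≟_ w → PalFactor u w
  palFactor⁻ {w = w} m with ∈-filter⁻ palindrome? {xs = factors _≟_ w} (∈-deduplicate⁻ (_≟w_ _≟_) _ m)
  ... | f , pal = factor⁻ f , pal

  palFactors-unique : ∀ w → Unique (palFactors _≟_ w)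
  palFactors-unique w = DecUniqueProperties.deduplicate-! (_≟w_ _≟_) (filter palindrome? (factors _≟_ w))

  factor? : ∀ (u w : List A) → Factor u w ⊎ ¬ Factor u w
  factor? u w with DecMembership._∈?_ (_≟w_ _≟_) u (factors _≟_ w)
  ... | yes m = inj₁ (factor⁻ m)
  ... | no m = inj₂ (λ f → m (factor⁺ f))

  #pal-mono : ∀ {w₁ w₂} → (∀ {u} → PalFactor u w₁ → PalFactor u w₂) → #pal w₁ ≤ #pal w₂
  #pal-mono {w₁} sub = unique-⊆-length (palFactors-unique w₁) (λ m → palFactor⁺ (sub (palFactor⁻ {w = w₁} m)))

  #pal-mono-but-one : ∀ {w₁ w₂} v → (∀ {u} → PalFactor u w₁ → PalFactor u w₂ ⊎ u ≡ v) → #pal w₁ ≤ suc (#pal w₂)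
  #pal-mono-but-one {w₁} {w₂} v sub = unique-⊆-length {ys = v ∷ palFactors _≟_ w₂} (palFactors-unique w₁) into
    where
    into : ∀ {u} → u ∈ palFactors _≟_ w₁ → u ∈ v ∷ palFactors _≟_ w₂
    into m with sub (palFactor⁻ {w = w₁} m)
    ... | inj₁ q = there (palFactor⁺ q)
    ... | inj₂ refl = here refl

  new-factor-suffix : ∀ {u w : List A} {c} → Factor u (w ∷ʳ c) → ¬ Factor u w → ∃ λ p → w ∷ʳ c ≡ p ++ u
  new-factor-suffix {u} (p , [] , eq) _ = p , trans eq (cong (p ++_) (++-identityʳ u))
  new-factor-suffix (p , s@(_ ∷ _) , eq) new = ⊥-elim (new (factor-of-init p _ s eq λ ()))

  -- a palindromic suffix v₁ of a palindromic suffix v₂ of w ∷ʳ c is also a prefix of v₂;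
  -- if it is a proper one, v₁ occurs in w
  nested-palindromic-suffix : ∀ {w : List A} {c} p v₁ v₂ m → Palindrome v₁ → Palindrome v₂ → v₂ ≡ m ++ v₁ →
                              w ∷ʳ c ≡ p ++ v₂ → m ≢ [] → Factor v₁ w
  nested-palindromic-suffix {w} {c} p v₁ v₂ m pal₁ pal₂ v₂≡ eq m≢[] =
    factor-of-init p v₁ (reverse m) (trans eq (cong (p ++_) v₂-mirror)) (reverse-≢[] m≢[])
    where
    open ≡-Reasoning
    v₂-mirror : v₂ ≡ v₁ ++ reverse m
    v₂-mirror = begin
      v₂                      ≡⟨ pal₂ ⟨
      reverse v₂              ≡⟨ cong reverse v₂≡ ⟩
      reverse (m ++ v₁)       ≡⟨ reverse-++ m v₁ ⟩
      reverse v₁ ++ reverse m ≡⟨ cong (_++ reverse m) pal₁ ⟩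
      v₁ ++ reverse m         ∎

  -- two new palindromic factors of w ∷ʳ c are nested palindromic suffixes, hence equal
  new-palindrome-unique : ∀ {u₁ u₂ w : List A} {c} → PalFactor u₁ (w ∷ʳ c) → PalFactor u₂ (w ∷ʳ c) →
                          ¬ Factor u₁ w → ¬ Factor u₂ w → u₁ ≡ u₂
  new-palindrome-unique {u₁} {u₂} (f₁ , pal₁) (f₂ , pal₂) new₁ new₂
    with new-factor-suffix f₁ new₁ | new-factor-suffix f₂ new₂
  ... | p₁ , eq₁ | p₂ , eq₂ with levi-suffix p₁ u₁ p₂ u₂ (trans (sym eq₁) eq₂)
  ...   | inj₁ ([] , refl) = refl
  ...   | inj₁ (m@(_ ∷ _) , u₂≡) = ⊥-elim (new₁ (nested-palindromic-suffix p₂ u₁ u₂ m pal₁ pal₂ u₂≡ eq₂ λ ()))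
  ...   | inj₂ ([] , refl) = refl
  ...   | inj₂ (m@(_ ∷ _) , u₁≡) = ⊥-elim (new₂ (nested-palindromic-suffix p₁ u₂ u₁ m pal₂ pal₁ u₁≡ eq₁ λ ()))

  #pal-snoc : ∀ w c → #pal (w ∷ʳ c) ≤ suc (#pal w)
  #pal-snoc w c with any? (λ v → ¬? (DecMembership._∈?_ (_≟w_ _≟_) v (factors _≟_ w))) (palFactors _≟_ (w ∷ʳ c))
  ... | no no-new = #pal-mono-but-one [] old
    where
    old : ∀ {u} → PalFactor u (w ∷ʳ c) → PalFactor u w ⊎ u ≡ []
    old {u} q@(_ , pal) with factor? u w
    ... | inj₁ f = inj₁ (f , pal)
    ... | inj₂ new = ⊥-elim (no-new (lose (palFactor⁺ q) (λ m → new (factor⁻ m))))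
  ... | yes some with find some
  ...   | v , v∈ , v-new = #pal-mono-but-one v old-or-v
    where
    old-or-v : ∀ {u} → PalFactor u (w ∷ʳ c) → PalFactor u w ⊎ u ≡ v
    old-or-v {u} q@(_ , pal) with factor? u w
    ... | inj₁ f = inj₁ (f , pal)
    ... | inj₂ new = inj₂ (new-palindrome-unique q (palFactor⁻ {w = w ∷ʳ c} v∈) new (λ f → v-new (factor⁺ f)))

  #pal-++ : ∀ w t → #pal (w ++ t) ≤ #pal w + length t
  #pal-++ w [] = subst (λ v → #pal v ≤ #pal w + 0) (sym (++-identityʳ w)) (m≤m+n _ 0)
  #pal-++ w (c ∷ t) = begin
    #pal (w ++ c ∷ t)            ≡⟨ cong #pal (++-assoc w [ c ] t) ⟨
    #pal ((w ∷ʳ c) ++ t)         ≤⟨ #pal-++ (w ∷ʳ c) t ⟩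
    #pal (w ∷ʳ c) + length t     ≤⟨ +-monoˡ-≤ (length t) (#pal-snoc w c) ⟩
    suc (#pal w) + length t      ≡⟨ +-suc (#pal w) (length t) ⟨
    #pal w + length (c ∷ t)      ∎
    where open ≤-Reasoning

  -- the palindromic factors of the mirror image are the mirror images of the palindromic factors
  #pal-reverse : ∀ w → #pal (reverse w) ≤ #pal w
  #pal-reverse w = subst (_≤ #pal w) (length-map reverse (palFactors _≟_ (reverse w)))
    (unique-⊆-length (UniqueProperties.map⁺ reverse-injective (palFactors-unique (reverse w))) mirrored)
    where
    mirrored : ∀ {v} → v ∈ map reverse (palFactors _≟_ (reverse w)) → v ∈ palFactors _≟_ w
    mirrored m with ∈-map⁻ reverse m
    ... | u , u∈ , refl with palFactor⁻ {w = reverse w} u∈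
    ...   | f , pal = palFactor⁺ {w = w} (factor-reverse {w = w} f , trans (reverse-involutive u) (sym pal))

  #pal-cons : ∀ c w → #pal (c ∷ w) ≤ suc (#pal w)
  #pal-cons c w = begin
    #pal (c ∷ w)                           ≡⟨ cong #pal c∷w-mirror ⟩
    #pal (reverse (reverse w ∷ʳ c))        ≤⟨ #pal-reverse (reverse w ∷ʳ c) ⟩
    #pal (reverse w ∷ʳ c)                  ≤⟨ #pal-snoc (reverse w) c ⟩
    suc (#pal (reverse w))                 ≤⟨ s≤s (#pal-reverse w) ⟩
    suc (#pal w)                           ∎
    where
    open ≤-Reasoning
    c∷w-mirror : c ∷ w ≡ reverse (reverse w ∷ʳ c)
    c∷w-mirror = sym (trans (reverse-++ (reverse w) [ c ]) (cong (c ∷_) (reverse-involutive w)))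

  #pal-infix : ∀ s v t → #pal (s ++ v ++ t) ≤ length s + (#pal v + length t)
  #pal-infix [] v t = #pal-++ v t
  #pal-infix (c ∷ s) v t = ≤-trans (#pal-cons c (s ++ v ++ t)) (s≤s (#pal-infix s v t))

  #pal-bound : ∀ w → #pal w ≤ suc (length w)
  #pal-bound w = #pal-++ [] w

  -- if c u c is a complete return whose middle u is not a palindrome, then the last letter
  -- creates no new palindromic factor: every palindromic factor of c u c occurs in c u
  #pal-return : ∀ c u → c ∉ u → ¬ Palindrome u → #pal ((c ∷ u) ∷ʳ c) ≤ #pal (c ∷ u)
  #pal-return c u c∉u u-not-pal = #pal-mono λ { (f , pal) → occurs-in-prefix _ f pal , pal }
    where
    middle-palindrome : Palindrome ((c ∷ u) ∷ʳ c) → Palindrome u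
    middle-palindrome pal = proj₁ (∷ʳ-injective (reverse u) u (∷-injectiveʳ (trans (sym unfold) pal)))
      where
      unfold : reverse ((c ∷ u) ∷ʳ c) ≡ c ∷ (reverse u ∷ʳ c)
      unfold = trans (reverse-++ (c ∷ u) [ c ]) (cong (c ∷_) (unfold-reverse c u))

    -- a palindromic suffix c ∷ r of c ∷ u ∷ʳ c is the whole word, or [ c ] (as c ∉ u)
    suffix-occurs : ∀ v p r → v ≡ c ∷ r → Palindrome v → (c ∷ u) ∷ʳ c ≡ p ++ c ∷ r → Factor v (c ∷ u)
    suffix-occurs v [] r refl pal eq = ⊥-elim (u-not-pal (middle-palindrome (subst Palindrome (sym eq) pal)))
    suffix-occurs v (_ ∷ p) [] refl pal eq = [] , u , refl
    suffix-occurs v (_ ∷ p) r@(_ ∷ _) refl pal eq with factor-of-init p [ c ] r (∷-injectiveʳ eq) (λ ())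
    ... | q , s , refl = ⊥-elim (c∉u (∈-++⁺ʳ q (here refl)))

    occurs-in-prefix : ∀ v → Factor v ((c ∷ u) ∷ʳ c) → Palindrome v → Factor v (c ∷ u)
    occurs-in-prefix v f pal with factor? v (c ∷ u)
    ... | inj₁ old = old
    ... | inj₂ new with new-factor-suffix f new | initLast v
    ...   | p , eq | [] = [] , _ , refl
    ...   | p , eq | v′ ∷ʳ′ d =
      suffix-occurs (v′ ∷ʳ d) p (reverse v′) starts-with-c pal (trans eq (cong (p ++_) starts-with-c))
      where
      d≡c : d ≡ c
      d≡c = sym (proj₂ (∷ʳ-injective (c ∷ u) (p ++ v′) (trans eq (sym (++-assoc p v′ [ d ])))))
      starts-with-c : v′ ∷ʳ d ≡ c ∷ reverse v′
      starts-with-c = trans (sym pal) (trans (reverse-++ v′ [ d ]) (cong (_∷ reverse v′) d≡c))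

  rich⇒returns-palindromic : ∀ w → Rich _≟_ w → ReturnsPalindromic w
  rich⇒returns-palindromic w rich s c u t c∉u w≡ with palindrome? u
  ... | yes pal = pal
  ... | no u-not-pal = ⊥-elim (1+n≰n (begin
    suc (length w)                                     ≡⟨ rich ⟨
    #pal w                                             ≡⟨ cong #pal w-return ⟩
    #pal (s ++ ((c ∷ u) ∷ʳ c) ++ t)                     ≤⟨ #pal-infix s ((c ∷ u) ∷ʳ c) t ⟩
    length s + (#pal ((c ∷ u) ∷ʳ c) + length t)         ≤⟨ +-monoʳ-≤ (length s) (+-monoˡ-≤ (length t) (#pal-return c u c∉u u-not-pal)) ⟩
    length s + (#pal (c ∷ u) + length t)                ≤⟨ +-monoʳ-≤ (length s) (+-monoˡ-≤ (length t) (#pal-bound (c ∷ u))) ⟩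
    length s + (suc (length (c ∷ u)) + length t)        ≡⟨ cong (λ n → length s + (suc n + length t)) (length-++-comm u [ c ]) ⟨
    length s + (length ((c ∷ u) ∷ʳ c) + length t)       ≡⟨ cong (length s +_) (length-++ ((c ∷ u) ∷ʳ c)) ⟨
    length s + length (((c ∷ u) ∷ʳ c) ++ t)             ≡⟨ length-++ s ⟨
    length (s ++ ((c ∷ u) ∷ʳ c) ++ t)                   ≡⟨ cong length w-return ⟨
    length w                                           ∎))
    where
    open ≤-Reasoning
    w-return : w ≡ s ++ ((c ∷ u) ∷ʳ c) ++ t
    w-return = trans w≡ (cong (λ v → s ++ c ∷ v) (sym (++-assoc u [ c ] t)))

-- Admissible words: square-free words whose complete returns to letters are palindromic

module _ {A : Set} where

  open MonoidSolver (++-monoid A) using (solve; _⊜_; _⊕_)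

  Admissible : List A → Set
  Admissible w = SquareFree w × ReturnsPalindromic w

  reverse-marks : ∀ (p : List A) c u d q → reverse (p ++ c ∷ u ++ d ∷ q) ≡ reverse q ++ d ∷ reverse u ++ c ∷ reverse p
  reverse-marks p c u d q = begin
    reverse (p ++ c ∷ u ++ d ∷ q)             ≡⟨ reverse-mid p c (u ++ d ∷ q) ⟩
    reverse (u ++ d ∷ q) ++ c ∷ reverse p     ≡⟨ cong (_++ c ∷ reverse p) (reverse-mid u d q) ⟩
    (reverse q ++ d ∷ reverse u) ++ c ∷ reverse p ≡⟨ ++-assoc (reverse q) (d ∷ reverse u) (c ∷ reverse p) ⟩
    reverse q ++ d ∷ reverse u ++ c ∷ reverse p ∎
    where open ≡-Reasoning

  admissible-infix : ∀ {w} p v s → w ≡ p ++ v ++ s → Admissible w → Admissible v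
  admissible-infix p v s w≡ (square-free , returns) = square-free′ , returns′
    where
    square-free′ : SquareFree v
    square-free′ p′ u s′ u≢[] refl = square-free (p ++ p′) u (s′ ++ s) u≢[] (trans w≡
      (solve 5 (λ P P′ U S′ S → P ⊕ ((P′ ⊕ (U ⊕ (U ⊕ S′))) ⊕ S) ⊜ (P ⊕ P′) ⊕ (U ⊕ (U ⊕ (S′ ⊕ S)))) refl p p′ u s′ s))
    returns′ : ReturnsPalindromic v
    returns′ s′ c u t c∉u refl = returns (p ++ s′) c u (t ++ s) c∉u (trans w≡
      (solve 6 (λ P S′ C U T S → P ⊕ ((S′ ⊕ (C ⊕ (U ⊕ (C ⊕ T)))) ⊕ S) ⊜ (P ⊕ S′) ⊕ (C ⊕ (U ⊕ (C ⊕ (T ⊕ S))))) refl p s′ [ c ] u t s))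

  admissible-suffix : ∀ {w} p v → w ≡ p ++ v → Admissible w → Admissible v
  admissible-suffix p v w≡ = admissible-infix p v [] (trans w≡ (cong (p ++_) (sym (++-identityʳ v))))

  admissible-reverse : ∀ w → Admissible w → Admissible (reverse w)
  admissible-reverse w (square-free , returns) = square-free′ , returns′
    where
    open ≡-Reasoning
    mirror : ∀ {v} → reverse w ≡ v → w ≡ reverse v
    mirror refl = sym (reverse-involutive w)
    square-free′ : SquareFree (reverse w)
    square-free′ p u s u≢[] eq = square-free (reverse s) (reverse u) (reverse p) (reverse-≢[] u≢[]) (begin
      w                                               ≡⟨ mirror eq ⟩
      reverse (p ++ u ++ u ++ s)                      ≡⟨ reverse-++ p (u ++ u ++ s) ⟩
      reverse (u ++ u ++ s) ++ reverse p              ≡⟨ cong (_++ reverse p) (reverse-++ u (u ++ s)) ⟩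
      (reverse (u ++ s) ++ reverse u) ++ reverse p    ≡⟨ cong (λ v → (v ++ reverse u) ++ reverse p) (reverse-++ u s) ⟩
      ((reverse s ++ reverse u) ++ reverse u) ++ reverse p
        ≡⟨ solve 3 (λ S U P → ((S ⊕ U) ⊕ U) ⊕ P ⊜ S ⊕ (U ⊕ (U ⊕ P))) refl (reverse s) (reverse u) (reverse p) ⟩
      reverse s ++ reverse u ++ reverse u ++ reverse p ∎)
    returns′ : ReturnsPalindromic (reverse w)
    returns′ s c u t c∉u eq = sym (trans (sym (reverse-involutive u)) reverse-u-palindrome)
      where
      reverse-u-palindrome : Palindrome (reverse u)
      reverse-u-palindrome = returns (reverse t) c (reverse u) (reverse s) (λ m → c∉u (∈-reverse⁻ m))
                               (trans (mirror eq) (reverse-marks s c u c t))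

-- The special letters of an admissible word

module SpecialLetters {A : Set} (_≟_ : DecidableEquality A) where

  open Occurrences _≟_
  open MonoidSolver (++-monoid A) using (solve; _⊜_; _⊕_)

  _∈?_ : ∀ (c : A) u → Dec (c ∈ u)
  _∈?_ = DecMembership._∈?_ _≟_

  word : List A → A → List A → A → List A → List A
  word x b y a z = x ++ b ∷ y ++ a ∷ z

  -- the hypotheses of the theorem: the word is admissible, the marked b is its left special
  -- letter (b ∉ x, x contains every other letter), the marked a its right special letter
  record Special (x : List A) (b : A) (y : List A) (a : A) (z : List A) : Set where
    field
      admissible : Admissible (word x b y a z)
      b∉x : b ∉ x
      x-covers : ∀ {c} → c ∈ word x b y a z → c ≢ b → c ∈ x
      a∉z : a ∉ z
      z-covers : ∀ {c} → c ∈ word x b y a z → c ≢ a → c ∈ z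

  record Conclusion (x : List A) (b : A) (y : List A) (a : A) (z : List A) : Set where
    field
      a≢b : a ≢ b
      a∉y : a ∉ y
      b∉y : b ∉ y
      y-covers : ∀ {c} → c ∈ word x b y a z → c ≢ a → c ≢ b → c ∈ y

  open Special
  open Conclusion

  module _ {x : List A} {b : A} {y : List A} {a : A} {z : List A} where

    ∈-x : ∀ {c} → c ∈ x → c ∈ word x b y a z
    ∈-x = ∈-++⁺ˡ

    ∈-b : b ∈ word x b y a z
    ∈-b = ∈-++⁺ʳ x (here refl)

    ∈-y : ∀ {c} → c ∈ y → c ∈ word x b y a z
    ∈-y m = ∈-++⁺ʳ x (there (∈-++⁺ˡ m))

    ∈-a : a ∈ word x b y a z
    ∈-a = ∈-++⁺ʳ x (there (∈-++⁺ʳ y (here refl)))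

    ∈-z : ∀ {c} → c ∈ z → c ∈ word x b y a z
    ∈-z m = ∈-++⁺ʳ x (there (∈-++⁺ʳ y (there m)))

    ∈-word⁻ : ∀ {c} → c ∈ word x b y a z → c ∈ x ⊎ c ≡ b ⊎ c ∈ y ⊎ c ≡ a ⊎ c ∈ z
    ∈-word⁻ m with ∈-++⁻ x m
    ... | inj₁ m′ = inj₁ m′
    ... | inj₂ (here refl) = inj₂ (inj₁ refl)
    ... | inj₂ (there m′) with ∈-++⁻ y m′
    ...   | inj₁ m″ = inj₂ (inj₂ (inj₁ m″))
    ...   | inj₂ (here refl) = inj₂ (inj₂ (inj₂ (inj₁ refl)))
    ...   | inj₂ (there m″) = inj₂ (inj₂ (inj₂ (inj₂ m″)))

    word-reverse : reverse (word x b y a z) ≡ word (reverse z) a (reverse y) b (reverse x)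
    word-reverse = reverse-marks x b y a z

    ∈-word-reverse : ∀ {c} → c ∈ word (reverse z) a (reverse y) b (reverse x) → c ∈ word x b y a z
    ∈-word-reverse m = ∈-reverse⁻ (subst (_ ∈_) (sym word-reverse) m)

    special-reverse : Special x b y a z → Special (reverse z) a (reverse y) b (reverse x)
    special-reverse sp = record
      { admissible = subst Admissible word-reverse (admissible-reverse _ (admissible sp))
      ; b∉x = λ m → a∉z sp (∈-reverse⁻ m)
      ; x-covers = λ m c≢a → ∈-reverse⁺ (z-covers sp (∈-word-reverse m) c≢a)
      ; a∉z = λ m → b∉x sp (∈-reverse⁻ m)
      ; z-covers = λ m c≢b → ∈-reverse⁺ (x-covers sp (∈-word-reverse m) c≢b)
      }

    conclusion-unreverse : Conclusion (reverse z) a (reverse y) b (reverse x) → Conclusion x b y a z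
    conclusion-unreverse cl = record
      { a≢b = λ a≡b → a≢b cl (sym a≡b)
      ; a∉y = λ m → b∉y cl (∈-reverse⁺ m)
      ; b∉y = λ m → a∉y cl (∈-reverse⁺ m)
      ; y-covers = λ m c≢a c≢b →
          ∈-reverse⁻ (y-covers cl (subst (_ ∈_) word-reverse (∈-reverse⁺ m)) c≢b c≢a)
      }

  Below : ℕ → Set
  Below n = ∀ {x b y a z} → length (word x b y a z) < n → Special x b y a z → Conclusion x b y a z

  below-reverse : ∀ {x b y a z} → Below (length (word x b y a z)) → Below (length (word (reverse z) a (reverse y) b (reverse x)))
  below-reverse {x} {b} {y} {a} {z} ih =
    subst Below (trans (sym (length-reverse (word x b y a z))) (cong length (word-reverse {x} {b} {y} {a} {z}))) ih

  -- if x is empty, every letter of w = b d r is b, in particular d, and w begins with the square b b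
  private
    second-letter-square : ∀ {b y a z} → Special [] b y a z → ∀ d r → y ++ a ∷ z ≡ d ∷ r → ⊥
    second-letter-square {b} sp d r eq with d ≟ b
    ... | yes refl = proj₁ (admissible sp) [] [ b ] r (λ ()) (cong (b ∷_) eq)
    ... | no d≢b with x-covers sp (subst (d ∈_) (cong (b ∷_) (sym eq)) (there (here refl))) d≢b
    ...   | ()

  x-nonempty : ∀ {b y a z} → ¬ Special [] b y a z
  x-nonempty {y = []} {a} {z} sp = second-letter-square sp a z refl
  x-nonempty {y = d ∷ y} {a} {z} sp = second-letter-square sp d (y ++ a ∷ z) refl

  FirstUnique : List A → Set
  FirstUnique x = ∃₂ λ e X → x ≡ e ∷ X × e ∉ X

  drop-first : ∀ {h x b y a z} → h ∈ x → Special (h ∷ x) b y a z → Special x b y a z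
  drop-first {h} {x} h∈x sp = record
    { admissible = admissible-suffix [ h ] _ refl (admissible sp)
    ; b∉x = λ m → b∉x sp (there m)
    ; x-covers = λ m c≢b → into-x (x-covers sp (there m) c≢b)
    ; a∉z = a∉z sp
    ; z-covers = λ m → z-covers sp (there m)
    }
    where
    into-x : ∀ {c} → c ∈ h ∷ x → c ∈ x
    into-x (here refl) = h∈x
    into-x (there m) = m

  undrop-first : ∀ {h x b y a z} → h ∈ x → Conclusion x b y a z → Conclusion (h ∷ x) b y a z
  undrop-first h∈x cl = record
    { a≢b = a≢b cl
    ; a∉y = a∉y cl
    ; b∉y = b∉y cl
    ; y-covers = λ { (here refl) → y-covers cl (∈-x h∈x) ; (there m) → y-covers cl m }
    }

  left-normal : ∀ {x b y a z} → Below (length (word x b y a z)) → Special x b y a z → FirstUnique x ⊎ Conclusion x b y a z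
  left-normal {[]} ih sp = ⊥-elim (x-nonempty sp)
  left-normal {h ∷ x} ih sp with h ∈? x
  ... | yes h∈x = inj₂ (undrop-first h∈x (ih ≤-refl (drop-first h∈x sp)))
  ... | no h∉x = inj₁ (h , x , refl , h∉x)

  -- X b K b (reverse X), found inside w with no occurrence of e, satisfies the hypotheses with a = b
  -- and is shorter than w, contradicting the induction hypothesis (which yields b ≢ b)
  private
    no-b-return-around : ∀ {e X b y a z K W} → Below (length (word (e ∷ X) b y a z)) → Special (e ∷ X) b y a z →
                         word (e ∷ X) b y a z ≡ [] ++ e ∷ word X b K b (reverse X) ++ e ∷ W → e ∉ K → ⊥
    no-b-return-around {e} {X} {b} {y} {a} {z} {K} {W} ih sp w≡ e∉K =
      a≢b (ih (shorter-factor [] e V (e ∷ W) w≡) special-V) refl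
      where
      V = word X b K b (reverse X)
      into-w : ∀ {c} → c ∈ V → c ∈ word (e ∷ X) b y a z
      into-w {c} m = subst (c ∈_) (sym w≡) (there (∈-++⁺ˡ m))
      X-covers : ∀ {c} → c ∈ V → c ≢ b → c ∈ X
      X-covers m c≢b with ∈-word⁻ m
      ... | inj₁ m′ = m′
      ... | inj₂ (inj₁ refl) = ⊥-elim (c≢b refl)
      ... | inj₂ (inj₂ (inj₂ (inj₁ refl))) = ⊥-elim (c≢b refl)
      ... | inj₂ (inj₂ (inj₂ (inj₂ m′))) = ∈-reverse⁻ m′
      ... | inj₂ (inj₂ (inj₁ m′)) with x-covers sp (into-w m) c≢b
      ...   | here refl = ⊥-elim (e∉K m′)
      ...   | there m″ = m″
      special-V : Special X b K b (reverse X)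
      special-V = record
        { admissible = admissible-infix [ e ] V (e ∷ W) w≡ (admissible sp)
        ; b∉x = λ m → b∉x sp (there m)
        ; x-covers = X-covers
        ; a∉z = λ m → b∉x sp (there (∈-reverse⁻ m))
        ; z-covers = λ m c≢b → ∈-reverse⁺ (X-covers m c≢b)
        }

    -- the first return to the first letter e of x = e ∷ X is e X b M e; its middle X b M is a
    -- palindrome with b ∉ X, so M = X̃ unless M = K b X̃, which no-b-return-around excludes
    first-return-mirror : ∀ {e X b y a z M W} → Below (length (word (e ∷ X) b y a z)) → Special (e ∷ X) b y a z →
                          e ∉ X → y ++ a ∷ z ≡ M ++ e ∷ W → e ∉ M → M ≡ reverse X
    first-return-mirror {e} {X} {b} {y} {a} {z} {M} {W} ih sp e∉X yaz≡ e∉M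
      with align X b M (reverse M) b (reverse X) XbM-mirror (λ m → b∉x sp (there m))
      where
      w≡ : word (e ∷ X) b y a z ≡ [] ++ e ∷ (X ++ b ∷ M) ++ e ∷ W
      w≡ = cong (e ∷_) (trans (cong (λ v → X ++ b ∷ v) yaz≡) (sym (++-assoc X (b ∷ M) (e ∷ W))))
      e∉XbM : e ∉ X ++ b ∷ M
      e∉XbM m with ∈-++⁻ X m
      ... | inj₁ m′ = e∉X m′
      ... | inj₂ (here refl) = b∉x sp (here refl)
      ... | inj₂ (there m′) = e∉M m′
      XbM-mirror : X ++ b ∷ M ≡ reverse M ++ b ∷ reverse X
      XbM-mirror = trans (sym (proj₂ (admissible sp) [] e (X ++ b ∷ M) W e∉XbM w≡)) (reverse-mid X b M)
    ... | inj₁ (_ , _ , M≡) = M≡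
    ... | inj₂ (K , _ , M≡) = ⊥-elim (no-b-return-around ih sp w≡′ (λ m → e∉M (subst (_ ∈_) (sym M≡) (∈-++⁺ˡ m))))
      where
      w≡′ : word (e ∷ X) b y a z ≡ [] ++ e ∷ word X b K b (reverse X) ++ e ∷ W
      w≡′ = cong (e ∷_) (begin
        X ++ b ∷ y ++ a ∷ z                    ≡⟨ cong (λ v → X ++ b ∷ v) (trans yaz≡ (cong (_++ e ∷ W) M≡)) ⟩
        X ++ b ∷ (K ++ b ∷ reverse X) ++ e ∷ W ≡⟨ cong (λ v → X ++ b ∷ v) (++-assoc K (b ∷ reverse X) (e ∷ W)) ⟩
        X ++ b ∷ K ++ b ∷ reverse X ++ e ∷ W
          ≡⟨ solve 5 (λ X B K RX EW → X ⊕ (B ⊕ (K ⊕ (B ⊕ (RX ⊕ EW)))) ⊜ (X ⊕ (B ⊕ (K ⊕ (B ⊕ RX)))) ⊕ EW)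
               refl X [ b ] K (reverse X) (e ∷ W) ⟩
        (X ++ b ∷ K ++ b ∷ reverse X) ++ e ∷ W ∎)
        where open ≡-Reasoning

  mirror-after-b : ∀ {x b y a z} → Below (length (word x b y a z)) → Special x b y a z → FirstUnique x →
                   ∃ λ W → y ++ a ∷ z ≡ reverse x ++ W
  mirror-after-b {b = b} {y} {a} {z} ih sp (e , X , refl , e∉X) with first-occurrence e (y ++ a ∷ z) e-after-b
    where
    e-after-b : e ∈ y ++ a ∷ z
    e-after-b with e ≟ a
    ... | yes refl = ∈-++⁺ʳ y (here refl)
    ... | no e≢a = ∈-++⁺ʳ y (there (z-covers sp (here refl) e≢a))
  ... | M , W , yaz≡ , e∉M = W , (begin
    y ++ a ∷ z            ≡⟨ yaz≡ ⟩
    M ++ e ∷ W            ≡⟨ cong (_++ e ∷ W) (first-return-mirror ih sp e∉X yaz≡ e∉M) ⟩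
    reverse X ++ e ∷ W    ≡⟨ reverse-cons-++ e X W ⟨
    reverse (e ∷ X) ++ W  ∎)
    where open ≡-Reasoning

  MirrorEnd : List A → A → List A → Set
  MirrorEnd x a y = ∃ λ x₀ → x ≡ x₀ ++ a ∷ reverse y

  MirrorStart : List A → List A → Set
  MirrorStart y x = ∃ λ t → y ≡ reverse x ++ t

  mirror-dichotomy : ∀ (x y : List A) a z W → y ++ a ∷ z ≡ reverse x ++ W → MirrorEnd x a y ⊎ MirrorStart y x
  mirror-dichotomy x y a z W eq with levi y (a ∷ z) (reverse x) W eq
  ... | inj₁ (t , y≡ , _) = inj₂ (t , y≡)
  ... | inj₂ ([] , rx≡ , _) = inj₂ ([] , trans (sym (trans rx≡ (++-identityʳ y))) (sym (++-identityʳ (reverse x))))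
  ... | inj₂ (d ∷ m , rx≡ , az≡) with ∷-injective az≡
  ...   | refl , _ = inj₁ (reverse m , reverse-mid⁻ y a m rx≡)

  mirror-end-reverse : ∀ {z b y} → MirrorEnd (reverse z) b (reverse y) → ∃ λ z₁ → z ≡ reverse y ++ b ∷ z₁
  mirror-end-reverse {z} {b} {y} (z₀ , rz≡) = reverse z₀ ,
    trans (reverse-mid⁻ z₀ b (reverse (reverse y)) rz≡) (cong (λ v → reverse v ++ b ∷ reverse z₀) (reverse-involutive y))

  -- if x ends with a ỹ then a ≢ b (as a ∈ x) and b ∉ y (as the letters of y occur in x)
  mirror-end-facts : ∀ {x b y a z} → Special x b y a z → MirrorEnd x a y → a ≢ b × b ∉ y
  mirror-end-facts sp (x₀ , refl) =
    (λ { refl → b∉x sp (∈-++⁺ʳ x₀ (here refl)) }) , λ m → b∉x sp (∈-++⁺ʳ x₀ (there (∈-reverse⁺ m)))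

  -- if y begins with x̃ and a ≢ b then a ∈ y (as a ∈ x)
  mirror-start-contains : ∀ {x b y a z} → Special x b y a z → a ≢ b → MirrorStart y x → a ∈ y
  mirror-start-contains sp a≢b (t , refl) = ∈-++⁺ˡ (∈-reverse⁺ (x-covers sp ∈-a a≢b))

  -- a letter c ∉ y, c ≢ a, b occurring both in x₀ and in z₁ around the centre a ỹ b y a ỹ b:
  -- the return to c between its last occurrence in x₀ and its first in z₁ is a palindrome that
  -- starts, after a b-free part, with a and ends, before an a-free part, with b; so a = b
  private
    pinched-return : ∀ {x₁ c x₂ b y a z₂ z₃} →
      Special ((x₁ ++ c ∷ x₂) ++ a ∷ reverse y) b y a (reverse y ++ b ∷ z₂ ++ c ∷ z₃) →
      c ∉ x₂ → c ∉ z₂ → c ∉ y → c ≢ a → c ≢ b → a ≢ b → ⊥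
    pinched-return {x₁} {c} {x₂} {b} {y} {a} {z₂} {z₃} sp c∉x₂ c∉z₂ c∉y c≢a c≢b a≢b =
      a≢b (proj₁ (proj₂ (align-first x₂ a R (reverse z₂) b (reverse L) U-mirror b∉x₂ a∉rz₂)))
      where
      ry = reverse y
      R = ry ++ b ∷ y ++ a ∷ ry ++ b ∷ z₂
      L = x₂ ++ a ∷ ry ++ b ∷ y ++ a ∷ ry
      U = x₂ ++ a ∷ R
      w≡ : word ((x₁ ++ c ∷ x₂) ++ a ∷ ry) b y a (ry ++ b ∷ z₂ ++ c ∷ z₃) ≡ x₁ ++ c ∷ U ++ c ∷ z₃
      w≡ = solve 9 (λ X₁ C X₂ A RY B Y Z₂ Z₃ →
             ((X₁ ⊕ (C ⊕ X₂)) ⊕ (A ⊕ RY)) ⊕ (B ⊕ (Y ⊕ (A ⊕ (RY ⊕ (B ⊕ (Z₂ ⊕ (C ⊕ Z₃)))))))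
             ⊜ X₁ ⊕ (C ⊕ ((X₂ ⊕ (A ⊕ (RY ⊕ (B ⊕ (Y ⊕ (A ⊕ (RY ⊕ (B ⊕ Z₂)))))))) ⊕ (C ⊕ Z₃))))
             refl x₁ [ c ] x₂ [ a ] ry [ b ] y z₂ z₃
      c∉ry : c ∉ ry
      c∉ry m = c∉y (∈-reverse⁻ m)
      c∉U : c ∉ U
      c∉U = ∉-++ c∉x₂ (∉-∷ c≢a (∉-++ c∉ry (∉-∷ c≢b (∉-++ c∉y (∉-∷ c≢a (∉-++ c∉ry (∉-∷ c≢b c∉z₂)))))))
      U≡ : U ≡ L ++ b ∷ z₂
      U≡ = solve 6 (λ X₂ A RY B Y Z₂ →
             X₂ ⊕ (A ⊕ (RY ⊕ (B ⊕ (Y ⊕ (A ⊕ (RY ⊕ (B ⊕ Z₂)))))))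
             ⊜ (X₂ ⊕ (A ⊕ (RY ⊕ (B ⊕ (Y ⊕ (A ⊕ RY)))))) ⊕ (B ⊕ Z₂))
             refl x₂ [ a ] ry [ b ] y z₂
      U-mirror : x₂ ++ a ∷ R ≡ reverse z₂ ++ b ∷ reverse L
      U-mirror = begin
        U                          ≡⟨ proj₂ (admissible sp) x₁ c U z₃ c∉U w≡ ⟨
        reverse U                  ≡⟨ cong reverse U≡ ⟩
        reverse (L ++ b ∷ z₂)      ≡⟨ reverse-mid L b z₂ ⟩
        reverse z₂ ++ b ∷ reverse L ∎
        where open ≡-Reasoning
      b∉x₂ : b ∉ x₂
      b∉x₂ m = b∉x sp (∈-++⁺ˡ (∈-++⁺ʳ x₁ (there m)))
      a∉rz₂ : a ∉ reverse z₂
      a∉rz₂ m = a∉z sp (∈-++⁺ʳ ry (there (∈-++⁺ˡ {ys = c ∷ z₃} (∈-reverse⁻ m))))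

  pinched : ∀ {x b y a z} → Special x b y a z → MirrorEnd x a y → (∃ λ z₁ → z ≡ reverse y ++ b ∷ z₁) → Conclusion x b y a z
  pinched {b = b} {y} {a} sp (x₀ , refl) (z₁ , refl) with mirror-end-facts sp (x₀ , refl)
  ... | a≢b , b∉y = record { a≢b = a≢b ; a∉y = a-outside-y ; b∉y = b∉y ; y-covers = covers }
    where
    a-outside-y : a ∉ y
    a-outside-y m = a∉z sp (∈-++⁺ˡ (∈-reverse⁺ m))
    in-x₀ : ∀ {c} → c ∈ word (x₀ ++ a ∷ reverse y) b y a (reverse y ++ b ∷ z₁) → c ≢ a → c ≢ b → c ∉ y → c ∈ x₀
    in-x₀ m c≢a c≢b c∉y with ∈-++⁻ x₀ (x-covers sp m c≢b)
    ... | inj₁ m′ = m′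
    ... | inj₂ m′ = ⊥-elim (∉-∷ c≢a (λ m″ → c∉y (∈-reverse⁻ m″)) m′)
    in-z₁ : ∀ {c} → c ∈ word (x₀ ++ a ∷ reverse y) b y a (reverse y ++ b ∷ z₁) → c ≢ a → c ≢ b → c ∉ y → c ∈ z₁
    in-z₁ m c≢a c≢b c∉y with ∈-++⁻ (reverse y) (z-covers sp m c≢a)
    ... | inj₂ (there m′) = m′
    ... | inj₂ (here refl) = ⊥-elim (c≢b refl)
    ... | inj₁ m′ = ⊥-elim (c∉y (∈-reverse⁻ m′))
    covers : ∀ {c} → c ∈ word (x₀ ++ a ∷ reverse y) b y a (reverse y ++ b ∷ z₁) → c ≢ a → c ≢ b → c ∈ y
    covers {c} m c≢a c≢b with c ∈? y
    ... | yes c∈y = c∈y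
    ... | no c∉y with last-occurrence c x₀ (in-x₀ m c≢a c≢b c∉y) | first-occurrence c z₁ (in-z₁ m c≢a c≢b c∉y)
    ...   | x₁ , x₂ , refl , c∉x₂ | z₂ , z₃ , refl , c∉z₂ = ⊥-elim (pinched-return sp c∉x₂ c∉z₂ c∉y c≢a c≢b a≢b)

  after-inner-b : ∀ {x b y a z y₁ y₂} → Below (length (word x b y a z)) → Special x b y a z →
                  MirrorStart y x → y ≡ y₁ ++ b ∷ y₂ → b ∉ y₁ → Conclusion y₁ b y₂ a z
  after-inner-b {x} {b} {y} {a} {z} {y₁} {y₂} ih sp (t , y≡rx++t) y≡ b∉y₁ =
    ih (shorter-suffix x b V w≡) special-V
    where
    V = word y₁ b y₂ a z
    w≡ : word x b y a z ≡ x ++ b ∷ V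
    w≡ = cong (λ v → x ++ b ∷ v) (trans (cong (_++ a ∷ z) y≡) (++-assoc y₁ (b ∷ y₂) (a ∷ z)))
    into-w : ∀ {c} → c ∈ V → c ∈ word x b y a z
    into-w {c} m = subst (c ∈_) (sym w≡) (∈-++⁺ʳ x (there m))
    rx-prefix : ∃ λ K → y₁ ≡ reverse x ++ K
    rx-prefix with prefix-or-past (reverse x) t y₁ b y₂ (trans (sym y≡rx++t) y≡)
    ... | inj₁ prefix = prefix
    ... | inj₂ (K , rx≡) = ⊥-elim (b∉x sp (∈-reverse⁻ (subst (b ∈_) (sym rx≡) (∈-++⁺ʳ y₁ (here refl)))))
    special-V : Special y₁ b y₂ a z
    special-V = record
      { admissible = admissible-suffix (x ++ [ b ]) V (trans w≡ (sym (++-assoc x [ b ] V))) (admissible sp)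
      ; b∉x = b∉y₁
      ; x-covers = λ m c≢b → subst (_ ∈_) (sym (proj₂ rx-prefix)) (∈-++⁺ˡ (∈-reverse⁺ (x-covers sp (into-w m) c≢b)))
      ; a∉z = a∉z sp
      ; z-covers = λ m → z-covers sp (into-w m)
      }

  -- if a = b does not occur in y and y begins with x̃ = X̃ e, then y = X̃ e X: y is a palindrome
  -- (a complete return to b), and the shorter word X b X̃ e T b z (with e in the role of b) shows e ∉ T
  centred-y : ∀ {x b y z e X} → Below (length (word x b y b z)) → Special x b y b z → x ≡ e ∷ X → e ∉ X → b ∉ y →
              MirrorStart y x → y ≡ reverse X ++ e ∷ X
  centred-y {x} {b} {y} {z} {e} {X} ih sp refl e∉X b∉y (T , y≡₀) = trans y≡ (cong (λ v → reverse X ++ e ∷ v) T≡X)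
    where
    y≡ : y ≡ reverse X ++ e ∷ T
    y≡ = trans y≡₀ (reverse-cons-++ e X T)
    V = word (X ++ b ∷ reverse X) e T b z
    w≡ : word (e ∷ X) b y b z ≡ e ∷ V
    w≡ = trans (cong (λ v → e ∷ X ++ b ∷ v ++ b ∷ z) y≡)
      (solve 6 (λ E X B RX T BZ → E ⊕ (X ⊕ (B ⊕ ((RX ⊕ (E ⊕ T)) ⊕ BZ))) ⊜ E ⊕ ((X ⊕ (B ⊕ RX)) ⊕ (E ⊕ (T ⊕ BZ))))
        refl [ e ] X [ b ] (reverse X) T (b ∷ z))
    into-w : ∀ {c} → c ∈ V → c ∈ word (e ∷ X) b y b z
    into-w {c} m = subst (c ∈_) (sym w≡) (there m)
    e≢b : e ≢ b
    e≢b refl = b∉x sp (here refl)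
    XbX̃-covers : ∀ {c} → c ∈ V → c ≢ e → c ∈ X ++ b ∷ reverse X
    XbX̃-covers {c} m c≢e with c ≟ b
    ... | yes refl = ∈-++⁺ʳ X (here refl)
    ... | no c≢b with x-covers sp (into-w m) c≢b
    ...   | here refl = ⊥-elim (c≢e refl)
    ...   | there m′ = ∈-++⁺ˡ m′
    special-V : Special (X ++ b ∷ reverse X) e T b z
    special-V = record
      { admissible = admissible-suffix [ e ] V w≡ (admissible sp)
      ; b∉x = ∉-++ e∉X (∉-∷ e≢b (λ m → e∉X (∈-reverse⁻ m)))
      ; x-covers = XbX̃-covers
      ; a∉z = a∉z sp
      ; z-covers = λ m → z-covers sp (into-w m)
      }
    e∉T : e ∉ T
    e∉T = Conclusion.b∉y (ih (shorter-suffix [] e V w≡) special-V)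
    y-mirror : reverse X ++ e ∷ T ≡ reverse T ++ e ∷ X
    y-mirror = begin
      reverse X ++ e ∷ T             ≡⟨ y≡ ⟨
      y                              ≡⟨ proj₂ (admissible sp) (e ∷ X) b y z b∉y refl ⟨
      reverse y                      ≡⟨ cong reverse y≡ ⟩
      reverse (reverse X ++ e ∷ T)   ≡⟨ reverse-mid (reverse X) e T ⟩
      reverse T ++ e ∷ reverse (reverse X) ≡⟨ cong (λ v → reverse T ++ e ∷ v) (reverse-involutive X) ⟩
      reverse T ++ e ∷ X             ∎
      where open ≡-Reasoning
    T≡X : T ≡ X
    T≡X = sym (reverse-injective (proj₁ (align-first (reverse X) e T (reverse T) e X y-mirror
            (λ m → e∉X (∈-reverse⁻ m)) (λ m → e∉T (∈-reverse⁻ m)))))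

  -- with a ≢ b, let y begin with x̃ and y = G a H b J where none of G, H, J contains a or b.
  -- The returns to b and to a around the inner a and b give H = G̃ and J = G, and x ends with
  -- a G̃ (as a ∈ x̃ and a ∉ G); so w contains the square (a G̃ b G)(a G̃ b G)
  two-marks-square : ∀ {x b y a z G H J} → Special x b y a z → a ≢ b → MirrorStart y x → y ≡ G ++ a ∷ H ++ b ∷ J →
                     a ∉ G → b ∉ G → a ∉ H → b ∉ H → a ∉ J → b ∉ J → ⊥
  two-marks-square {x} {b} {_} {a} {z} {G} {H} {J} sp a≢b (t , y≡) refl a∉G b∉G a∉H b∉H a∉J b∉J =
    proj₁ (admissible sp) (reverse K) u (a ∷ z) (λ ()) w-square
    where
    open ≡-Reasoning
    returns = proj₂ (admissible sp)
    -- the return to b: G a H is a palindrome, so H̃ = G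
    H̃≡G : reverse H ≡ G
    H̃≡G = proj₁ (align-first (reverse H) a (reverse G) G a H GaH-mirror (λ m → a∉H (∈-reverse⁻ m)) a∉G)
      where
      GaH-palindrome : Palindrome (G ++ a ∷ H)
      GaH-palindrome = returns x b (G ++ a ∷ H) (J ++ a ∷ z) (∉-++ b∉G (∉-∷ (λ b≡a → a≢b (sym b≡a)) b∉H))
        (solve 7 (λ X B G A H J AZ → X ⊕ (B ⊕ ((G ⊕ (A ⊕ (H ⊕ (B ⊕ J)))) ⊕ AZ)) ⊜ X ⊕ (B ⊕ ((G ⊕ (A ⊕ H)) ⊕ (B ⊕ (J ⊕ AZ)))))
          refl x [ b ] G [ a ] H J (a ∷ z))
      GaH-mirror : reverse H ++ a ∷ reverse G ≡ G ++ a ∷ H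
      GaH-mirror = trans (sym (reverse-mid G a H)) GaH-palindrome
    -- the return to a: H b J is a palindrome, so J̃ = H
    J̃≡H : reverse J ≡ H
    J̃≡H = proj₁ (align-first (reverse J) b (reverse H) H b J HbJ-mirror (λ m → b∉J (∈-reverse⁻ m)) b∉H)
      where
      HbJ-palindrome : Palindrome (H ++ b ∷ J)
      HbJ-palindrome = returns (x ++ b ∷ G) a (H ++ b ∷ J) z (∉-++ a∉H (∉-∷ a≢b a∉J))
        (solve 7 (λ X B G A H J AZ → X ⊕ (B ⊕ ((G ⊕ (A ⊕ (H ⊕ (B ⊕ J)))) ⊕ AZ)) ⊜ (X ⊕ (B ⊕ G)) ⊕ (A ⊕ ((H ⊕ (B ⊕ J)) ⊕ AZ)))
          refl x [ b ] G [ a ] H J (a ∷ z))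
      HbJ-mirror : reverse J ++ b ∷ reverse H ≡ H ++ b ∷ J
      HbJ-mirror = trans (sym (reverse-mid H b J)) HbJ-palindrome
    H≡G̃ : H ≡ reverse G
    H≡G̃ = trans (sym (reverse-involutive H)) (cong reverse H̃≡G)
    J≡G : J ≡ G
    J≡G = trans (sym (reverse-involutive J)) (trans (cong reverse J̃≡H) H̃≡G)
    -- x̃ is a prefix of y containing a, hence it extends past the first a of y
    x̃-past-a : ∃ λ K → reverse x ≡ G ++ a ∷ K
    x̃-past-a with prefix-or-past (reverse x) t G a (H ++ b ∷ J) (sym y≡)
    ... | inj₂ past = past
    ... | inj₁ (K , G≡) = ⊥-elim (a∉G (subst (a ∈_) (sym G≡) (∈-++⁺ˡ (∈-reverse⁺ (x-covers sp ∈-a a≢b)))))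
    K = proj₁ x̃-past-a
    x≡ : x ≡ reverse K ++ a ∷ reverse G
    x≡ = reverse-mid⁻ G a K (proj₂ x̃-past-a)
    u = a ∷ reverse G ++ b ∷ G
    w-square : word x b (G ++ a ∷ H ++ b ∷ J) a z ≡ reverse K ++ u ++ u ++ a ∷ z
    w-square = begin
      x ++ b ∷ (G ++ a ∷ H ++ b ∷ J) ++ a ∷ z
        ≡⟨ cong₂ (λ v v′ → v ++ b ∷ (G ++ a ∷ v′) ++ a ∷ z) x≡ (cong₂ (λ h j → h ++ b ∷ j) H≡G̃ J≡G) ⟩
      (reverse K ++ a ∷ reverse G) ++ b ∷ (G ++ a ∷ reverse G ++ b ∷ G) ++ a ∷ z
        ≡⟨ solve 6 (λ RK A RG B G AZ → (RK ⊕ (A ⊕ RG)) ⊕ (B ⊕ ((G ⊕ (A ⊕ (RG ⊕ (B ⊕ G)))) ⊕ AZ))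
                                     ⊜ RK ⊕ ((A ⊕ (RG ⊕ (B ⊕ G))) ⊕ ((A ⊕ (RG ⊕ (B ⊕ G))) ⊕ AZ)))
             refl (reverse K) [ a ] (reverse G) [ b ] G (a ∷ z) ⟩
      reverse K ++ u ++ u ++ a ∷ z ∎


  -- y begins with x̃ and ends with z̃, while a ≢ b. The induction hypothesis, applied to the parts
  -- of w after the first b of y and (by reversal) before the last a of y, shows that neither a nor
  -- b occurs in y after the first b or before the last a; so the last a precedes the first b and
  -- y has the shape of two-marks-square
  mirrors-inside-distinct : ∀ {x b y a z} → Below (length (word x b y a z)) → Special x b y a z → a ≢ b →
                            MirrorStart y x → MirrorStart (reverse y) (reverse z) → ⊥
  mirrors-inside-distinct {x} {b} {y} {a} {z} ih sp a≢b ms ms̃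
    with first-occurrence b y (∈-reverse⁻ (mirror-start-contains (special-reverse sp) (λ b≡a → a≢b (sym b≡a)) ms̃))
       | first-occurrence a (reverse y) (∈-reverse⁺ (mirror-start-contains sp a≢b ms))
  ... | y₁ , y₂ , y≡ , b∉y₁ | u , v , ỹ≡ , a∉u
    with after-inner-b ih sp ms y≡ b∉y₁ | after-inner-b (below-reverse {x} {b} {y} {a} {z} ih) (special-reverse sp) ms̃ ỹ≡ a∉u
  ... | after-b | before-a
    with align (reverse v) a (reverse u) y₁ b y₂ (trans (sym (reverse-mid⁻ u a v ỹ≡)) y≡)
               (λ m → Conclusion.a∉y before-a (∈-reverse⁻ m))
  ... | inj₁ (_ , a≡b , _) = a≢b a≡b
  ... | inj₂ (K , y₁≡ , ũ≡) = two-marks-square sp a≢b ms y-shape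
          (λ m → Conclusion.b∉y before-a (∈-reverse⁻ m)) (λ m → Conclusion.a∉y before-a (∈-reverse⁻ m))
          (λ m → a∉u (∈-reverse⁻ (subst (a ∈_) (sym ũ≡) (∈-++⁺ˡ m))))
          (λ m → b∉y₁ (subst (b ∈_) (sym y₁≡) (∈-++⁺ʳ (reverse v) (there m))))
          (Conclusion.a∉y after-b) (Conclusion.b∉y after-b)
    where
    y-shape : y ≡ reverse v ++ a ∷ K ++ b ∷ y₂
    y-shape = trans y≡ (trans (cong (_++ b ∷ y₂) y₁≡) (++-assoc (reverse v) (a ∷ K) (b ∷ y₂)))

  -- y begins with x̃ and ends with z̃, while a = b. If b occurs in y, the part of w after its first
  -- occurrence in y contradicts the induction hypothesis (a ≢ b). Otherwise, with x = e X and
  -- z̃ = e′ Z, y = X̃ e X = Z̃ e′ Z, so X = Z, e = e′, and w is the square (e X b X̃)(e X b X̃) followed by e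
  mirrors-inside-equal : ∀ {x b y z} → Below (length (word x b y b z)) → Special x b y b z →
                         FirstUnique x → FirstUnique (reverse z) → MirrorStart y x → MirrorStart (reverse y) (reverse z) → ⊥
  mirrors-inside-equal {x} {b} {y} {z} ih sp fu fũ ms ms̃ with b ∈? y
  ... | yes b∈y with first-occurrence b y b∈y
  ...   | y₁ , y₂ , y≡ , b∉y₁ = Conclusion.a≢b (after-inner-b ih sp ms y≡ b∉y₁) refl
  mirrors-inside-equal {x} {b} {y} {z} ih sp (e , X , refl , e∉X) (e′ , Z , z̃≡ , e′∉Z) ms ms̃ | no b∉y
    with centred-y ih sp refl e∉X b∉y ms
       | centred-y (below-reverse {e ∷ X} {b} {y} {b} {z} ih) (special-reverse sp) z̃≡ e′∉Z (λ m → b∉y (∈-reverse⁻ m)) ms̃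
  ... | y≡X | ỹ≡Z with centred-unique X e Z e′ (trans (sym y≡X) (reverse-≡-palindrome (centred-palindrome Z e′) ỹ≡Z))
  ... | refl , refl = proj₁ (admissible sp) [] u [ e ] (λ ()) (begin
    e ∷ X ++ b ∷ y ++ b ∷ z                                ≡⟨ cong₂ (λ v v′ → e ∷ X ++ b ∷ v ++ b ∷ v′) y≡X z≡ ⟩
    e ∷ X ++ b ∷ (reverse X ++ e ∷ X) ++ b ∷ reverse X ∷ʳ e
      ≡⟨ solve 4 (λ E X B RX → E ⊕ (X ⊕ (B ⊕ ((RX ⊕ (E ⊕ X)) ⊕ (B ⊕ (RX ⊕ E))))) ⊜ (E ⊕ (X ⊕ (B ⊕ RX))) ⊕ ((E ⊕ (X ⊕ (B ⊕ RX))) ⊕ E))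
           refl [ e ] X [ b ] (reverse X) ⟩
    u ++ u ++ [ e ]                                        ∎)
    where
    open ≡-Reasoning
    u = e ∷ X ++ b ∷ reverse X
    z≡ : z ≡ reverse X ∷ʳ e
    z≡ = trans (sym (reverse-involutive z)) (trans (cong reverse z̃≡) (unfold-reverse e X))

  -- the main case: both x and z̃ begin with a letter that does not recur in them. Then x̃ is a
  -- prefix of y a z and z̃ a prefix of ỹ b x̃; comparing lengths, either both mirror images end
  -- before the special letters (the pinched case), or one of them fits inside y, which is
  -- incompatible with the other ending early, or both fit inside y, which is impossible
  normal-case : ∀ {x b y a z} → Below (length (word x b y a z)) → Special x b y a z →
                FirstUnique x → FirstUnique (reverse z) → Conclusion x b y a z
  normal-case {x} {b} {y} {a} {z} ih sp fu fũ
    with mirror-after-b ih sp fu | mirror-after-b (below-reverse {x} {b} {y} {a} {z} ih) (special-reverse sp) fũ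
  ... | W , eq | W̃ , eq̃
    with mirror-dichotomy x y a z W eq | mirror-dichotomy (reverse z) (reverse y) b (reverse x) W̃ eq̃
  ... | inj₁ end | inj₁ ẽnd = pinched sp end (mirror-end-reverse {z} {b} {y} ẽnd)
  ... | inj₁ end | inj₂ s̃tart with mirror-end-facts sp end
  ...   | a≢b , b∉y = ⊥-elim (b∉y (∈-reverse⁻ (mirror-start-contains (special-reverse sp) (λ b≡a → a≢b (sym b≡a)) s̃tart)))
  normal-case {x} {b} {y} {a} {z} ih sp fu fũ | W , eq | W̃ , eq̃ | inj₂ start | inj₁ ẽnd
    with mirror-end-facts (special-reverse sp) ẽnd
  ... | b≢a , a∉ỹ = ⊥-elim (a∉ỹ (∈-reverse⁺ (mirror-start-contains sp (λ a≡b → b≢a (sym a≡b)) start)))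
  normal-case {x} {b} {y} {a} {z} ih sp fu fũ | W , eq | W̃ , eq̃ | inj₂ start | inj₂ s̃tart with a ≟ b
  ... | no a≢b = ⊥-elim (mirrors-inside-distinct ih sp a≢b start s̃tart)
  ... | yes refl = ⊥-elim (mirrors-inside-equal ih sp fu fũ start s̃tart)

  step : ∀ {x b y a z} → Below (length (word x b y a z)) → Special x b y a z → Conclusion x b y a z
  step {x} {b} {y} {a} {z} ih sp with left-normal ih sp
  ... | inj₂ done = done
  ... | inj₁ fu with left-normal (below-reverse {x} {b} {y} {a} {z} ih) (special-reverse sp)
  ...   | inj₂ done = conclusion-unreverse done
  ...   | inj₁ fũ = normal-case ih sp fu fũ

  -- strong induction on the length of w (no word is shorter than 0)
  below-all : ∀ n → Below n
  below-all (suc n) (s≤s |w|≤n) sp = step (λ shorter → below-all n (<-≤-trans shorter |w|≤n)) sp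

  special⇒conclusion : ∀ {x b y a z} → Special x b y a z → Conclusion x b y a z
  special⇒conclusion sp = below-all _ ≤-refl sp

lemma2p10 : {Σ : Set} (_≟_ : DecidableEquality Σ) (n : ℕ) → n ≥ 3 →
    (w x y z : List Σ) (a b : Σ) →
    Rich _≟_ w → SquareFree w → alphSize _≟_ w ≡ n →
    w ≡ x ++ b ∷ y ++ a ∷ z →
    AlphMinus z w a →
    AlphMinus x w b →
    ((∀ c → (c ∈ y) ⇔ ((c ∈ w) × (c ≢ a) × (c ≢ b))) × (a ≢ b))
lemma2p10 _≟_ _ _ w x y z a b rich square-free _ refl z-special x-special =
  (λ c → mk⇔ (λ c∈y → ∈-y c∈y , (λ { refl → a∉y conclusion c∈y }) , (λ { refl → b∉y conclusion c∈y }))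
             (λ { (c∈w , c≢a , c≢b) → y-covers conclusion c∈w c≢a c≢b }))
  , a≢b conclusion
  where
  open SpecialLetters _≟_
  open Conclusion
  conclusion : Conclusion x b y a z
  conclusion = special⇒conclusion record
    { admissible = square-free , PalindromicFactors.rich⇒returns-palindromic _≟_ w rich
    ; b∉x = λ b∈x → proj₂ (Equivalence.to (x-special b) b∈x) refl
    ; x-covers = λ c∈w c≢b → Equivalence.from (x-special _) (c∈w , c≢b)
    ; a∉z = λ a∈z → proj₂ (Equivalence.to (z-special a) a∈z) refl
    ; z-covers = λ c∈w c≢a → Equivalence.from (z-special _) (c∈w , c≢a)
    }
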